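{- Let $G=((X,Y),E)$ be a split graph with $\sigma(G)=2$ and even maximum degree $\Delta(G)$. Let $P$ be the set of pendant vertices of $G$. Then the following are equivalent: 1. $G$ is neighborhood-overfull. 2. There exists $v\in X$ such that $v$ is universal in $G[V\setminus P]$, $\Delta(G[N[v]])=\Delta(G)$, and $G[N[v]]$ is overfull.
   Context: All graphs are simple, finite, connected and undirected. A split graph $G=((X,Y),E)$ is a graph whose vertex set is partitioned into a clique $X$ and an independent set $Y$; $X$ is taken to be a maximal clique. A tree $t$-spanner of a connected graph $G$ is a spanning tree $T$ of $G$ with $d_T(u,w)\le t$ for every edge $uw$ of $G$. The stretch index $\sigma(G)$ is the least $t$ for which $G$ admits a tree $t$-spanner. Pendant vertices are the vertices of degree $1$. $N[v]=N(v)\cup\{v\}$ is the closed neighborhood of $v$, and $G[S]$ is the subgraph induced by $S$. A vertex is universal in a graph if it is adjacent to all other vertices of that graph. A graph $H$ is overfull if $|E(H)|>\Delta(H)\cdot\lfloor |V(H)|/2\rfloor$. $G$ is neighborhood-overfull if there is a vertex $v$ with $d_G(v)=\Delta(G)$ such that $G[N[v]]$ is overfull. In that case $\Delta(G[N[v]])=\Delta(G)$. -}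

module Defs where

open import Data.Nat using (ℕ; zero; suc; _+_; _*_; _⊔_; _<_; _≤_; _<ᵇ_; _/_)
open import Data.Bool using (Bool; true; false; if_then_else_; _∧_; not)
open import Data.Fin using (Fin; toℕ; inject₁; fromℕ)
import Data.Fin as F
open import Data.List using (List; []; _∷_; map; foldr)
open import Data.List using () renaming (allFin to allFinL)
open import Data.Product using (Σ; ∃; _×_; _,_)
open import Relation.Binary.PropositionalEquality using (_≡_; _≢_)
open import Relation.Nullary using (¬_)
open import Relation.Nullary.Decidable using (⌊_⌋)
open import Function.Definitions using (Injective)

countB : {A : Set} → (A → Bool) → List A → ℕ
countB p [] = 0
countB p (x ∷ xs) = if p x then suc (countB p xs) else countB p xs

maxL : List ℕ → ℕ
maxL = foldr _⊔_ 0

record Graph : Set where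
  field
    n     : ℕ
    adj   : Fin n → Fin n → Bool
    sym   : ∀ u v → adj u v ≡ adj v u
    irref : ∀ v → adj v v ≡ false
open Graph public

data Walk {m : ℕ} (E : Fin m → Fin m → Bool) : Fin m → Fin m → ℕ → Set where
  here : ∀ {u} → Walk E u u 0
  step : ∀ {u v w k} → E u v ≡ true → Walk E v w k → Walk E u w (suc k)

ConnectedE : {m : ℕ} → (Fin m → Fin m → Bool) → Set
ConnectedE {m} E = ∀ (u w : Fin m) → ∃ λ k → Walk E u w k

Connected : Graph → Set
Connected G = ConnectedE (adj G)

-- A cycle of length j+3: injective cyclic sequence of vertices
HasCycle : {m : ℕ} → (Fin m → Fin m → Bool) → Set
HasCycle {m} E =
  Σ ℕ λ j → Σ (Fin (suc (suc (suc j))) → Fin m) λ f →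
    Injective _≡_ _≡_ f ×
    (∀ (i : Fin (suc (suc j))) → E (f (inject₁ i)) (f (F.suc i)) ≡ true) ×
    (E (f (fromℕ (suc (suc j)))) (f F.zero) ≡ true)

DistLE : {m : ℕ} → (Fin m → Fin m → Bool) → Fin m → Fin m → ℕ → Set
DistLE E u w t = ∃ λ k → k ≤ t × Walk E u w k

IsTreeSpanner : (G : Graph) → (Fin (n G) → Fin (n G) → Bool) → ℕ → Set
IsTreeSpanner G T t =
  (∀ u v → T u v ≡ T v u) ×
  (∀ u v → T u v ≡ true → adj G u v ≡ true) ×
  ConnectedE T × ¬ HasCycle T ×
  (∀ u w → adj G u w ≡ true → DistLE T u w t)

HasTreeSpanner : Graph → ℕ → Set
HasTreeSpanner G t = Σ (Fin (n G) → Fin (n G) → Bool) λ T → IsTreeSpanner G T t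

StretchIndexIs : Graph → ℕ → Set
StretchIndexIs G s = HasTreeSpanner G s × (∀ t → t < s → ¬ HasTreeSpanner G t)

-- split graph with partition given by inX (true = in X, false = in Y);
-- X a clique, Y independent, X a maximal clique
IsSplit : (G : Graph) → (Fin (n G) → Bool) → Set
IsSplit G inX =
  (∀ u v → inX u ≡ true → inX v ≡ true → u ≢ v → adj G u v ≡ true) ×
  (∀ u v → inX u ≡ false → inX v ≡ false → adj G u v ≡ false) ×
  (∀ y → inX y ≡ false → ¬ (∀ x → inX x ≡ true → adj G y x ≡ true))

module _ (G : Graph) where
  verts : List (Fin (n G))
  verts = allFinL (n G)

  deg : Fin (n G) → ℕ
  deg v = countB (adj G v) verts

  Δ : ℕ
  Δ = maxL (map deg verts)

  -- induced subgraph G[S], S given as a Bool predicate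
  nV[_] : (Fin (n G) → Bool) → ℕ
  nV[ S ] = countB S verts

  degIn : (Fin (n G) → Bool) → Fin (n G) → ℕ
  degIn S v = countB (λ w → S w ∧ adj G v w) verts

  Δ[_] : (Fin (n G) → Bool) → ℕ
  Δ[ S ] = maxL (map (λ v → if S v then degIn S v else 0) verts)

  -- edges of G[S]: unordered pairs {u,w}, counted with toℕ u < toℕ w
  nE[_] : (Fin (n G) → Bool) → ℕ
  nE[ S ] = foldr _+_ 0 (map (λ u → countB (λ w → S u ∧ S w ∧ (toℕ u <ᵇ toℕ w) ∧ adj G u w) verts) verts)

  Overfull : (Fin (n G) → Bool) → Set
  Overfull S = Δ[ S ] * (nV[ S ] / 2) < nE[ S ]

  N[_] : Fin (n G) → Fin (n G) → Bool
  N[ v ] w = if ⌊ v F.≟ w ⌋ then true else adj G v w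

  Pendant : Fin (n G) → Set
  Pendant v = deg v ≡ 1

  NeighborhoodOverfull : Set
  NeighborhoodOverfull = ∃ λ v → deg v ≡ Δ × Overfull N[ v ]

-- Let v have maximum degree Δ = 2k with G[N[v]] overfull. A vertex of Y has smaller degree than
-- each of its neighbours (its neighbourhood is a proper part of the maximal clique X), so v ∈ X.
-- In a tree 2-spanner T, three vertices of X force a centre c ∈ X to which every other vertex of X
-- is T-adjacent, and every vertex of Y with two neighbours in X is adjacent to c.  Suppose a
-- non-pendant w ≠ v were not adjacent to v; then w ∈ Y and c ~ w.  If v has a pendant neighbour,
-- then 2|E(G[N[v]])| ≤ Δ² + 1, hence |E(G[N[v]])| ≤ Δk = Δ⌊|N[v]|/2⌋ since Δ is even, so G[N[v]]
-- is not overfull.  Otherwise every neighbour of v is adjacent to c, and N[v] ∪ {w} ⊆ N[c] gives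
-- deg c > Δ.  Conversely, Δ(G[N[v]]) ≤ |N[v]| − 1 = deg v forces deg v = Δ.

module Submission where

open import Defs renaming (sym to adj-sym)
open import Data.Nat using (ℕ; zero; suc; _+_; _*_; _≤_; _<_; z≤n; s≤s; s≤s⁻¹; _<ᵇ_; _/_)
open import Data.Nat.Properties
import Data.Nat as ℕ
open import Data.Nat.DivMod using (m*n/n≡m; /-monoˡ-≤)
open import Data.Bool using (Bool; true; false; if_then_else_; _∧_)
import Data.Bool as Bool
open import Data.Bool.Properties using (∧-conicalˡ; ∧-conicalʳ; ∧-zeroʳ; ¬-not)
open import Data.Fin using (Fin; toℕ; inject₁; fromℕ)
import Data.Fin as F
open import Data.List using (List; []; _∷_; map; foldr; tabulate)
open import Data.List.Membership.Propositional using (_∈_)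
open import Data.List.Membership.Propositional.Properties using (∈-allFin)
open import Data.List.Relation.Unary.Any using (here; there)
open import Data.Vec using (Vec; []; _∷_; lookup)
open import Data.Vec.Relation.Unary.Linked using (Linked; [-]; _∷_)
open import Data.Vec.Relation.Unary.All using ([]; _∷_)
open import Data.Vec.Relation.Unary.AllPairs using ([]; _∷_)
open import Data.Vec.Relation.Unary.Unique.Propositional using (Unique)
open import Data.Vec.Relation.Unary.Unique.Propositional.Properties using (lookup-injective)
open import Data.Product using (∃; _×_; _,_; proj₁; proj₂)
open import Data.Sum using (_⊎_; inj₁; inj₂; [_,_]′)
import Data.Sum as Sum
import Data.Fin.Properties as Fin
open import Data.Empty using (⊥; ⊥-elim)
open import Relation.Binary.PropositionalEquality
open import Relation.Nullary using (¬_; yes; no; ¬?; _×-dec_)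
open import Relation.Nullary.Decidable using (decidable-stable)
open import Function.Base using (_∘_; id)
open import Function.Bundles using (_⇔_; mk⇔)
open import Algebra.Properties.Semiring.Sum +-*-semiring
  using (sum; sum-syntax; ∑-distrib-+; ∑-comm; *-distribʳ-sum; sum-replicate-zero; sum-cong-≗)
open import Algebra.Properties.CommutativeSemigroup +-commutativeSemigroup using (xy∙z≈xz∙y)
open import Algebra.Properties.CommutativeSemigroup *-commutativeSemigroup using (x∙yz≈y∙xz)

true≢false : true ≢ false
true≢false ()

𝟙 : Bool → ℕ
𝟙 true  = 1
𝟙 false = 0

count : ∀ {m} → (Fin m → Bool) → ℕ
count {m} p = ∑[ i < m ] 𝟙 (p i)

private
  variable
    A : Set
    m : ℕ
    p q : Fin m → Bool

sum-mono-≤ : {f g : Fin m → ℕ} → (∀ i → f i ≤ g i) → sum f ≤ sum g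
sum-mono-≤ {zero}  _   = z≤n
sum-mono-≤ {suc m} f≤g = +-mono-≤ (f≤g F.zero) (sum-mono-≤ (f≤g ∘ F.suc))

sum-mono-≤-slack : {f g : Fin m → ℕ} → (∀ i → f i ≤ g i) →
                   ∀ x {a b} → f x + a ≤ g x + b → sum f + a ≤ sum g + b
sum-mono-≤-slack {suc m} {f} {g} f≤g F.zero {a} {b} slack = begin
  f F.zero + sum (f ∘ F.suc) + a   ≡⟨ xy∙z≈xz∙y (f F.zero) _ a ⟩
  f F.zero + a + sum (f ∘ F.suc)   ≤⟨ +-mono-≤ slack (sum-mono-≤ (f≤g ∘ F.suc)) ⟩
  g F.zero + b + sum (g ∘ F.suc)   ≡⟨ xy∙z≈xz∙y (g F.zero) _ b ⟨
  g F.zero + sum (g ∘ F.suc) + b   ∎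
  where open ≤-Reasoning
sum-mono-≤-slack {suc m} {f} {g} f≤g (F.suc x) {a} {b} slack = begin
  f F.zero + sum (f ∘ F.suc) + a   ≡⟨ +-assoc (f F.zero) _ a ⟩
  f F.zero + (sum (f ∘ F.suc) + a) ≤⟨ +-mono-≤ (f≤g F.zero)
                                              (sum-mono-≤-slack (f≤g ∘ F.suc) x slack) ⟩
  g F.zero + (sum (g ∘ F.suc) + b) ≡⟨ +-assoc (g F.zero) _ b ⟨
  g F.zero + sum (g ∘ F.suc) + b   ∎
  where open ≤-Reasoning

countB-tabulate : (p : A → Bool) (g : Fin m → A) → countB p (tabulate g) ≡ count (p ∘ g)
countB-tabulate {m = zero}  p g = refl
countB-tabulate {m = suc m} p g with p (g F.zero)
... | true  = cong suc (countB-tabulate p (g ∘ F.suc))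
... | false = countB-tabulate p (g ∘ F.suc)

foldr-+-tabulate : (h : A → ℕ) (g : Fin m → A) → foldr _+_ 0 (map h (tabulate g)) ≡ sum (h ∘ g)
foldr-+-tabulate {m = zero}  h g = refl
foldr-+-tabulate {m = suc m} h g = cong (h (g F.zero) +_) (foldr-+-tabulate h (g ∘ F.suc))

𝟙-mono : ∀ {a b} → (a ≡ true → b ≡ true) → 𝟙 a ≤ 𝟙 b
𝟙-mono {false} _   = z≤n
𝟙-mono {true}  a⇒b rewrite a⇒b refl = ≤-refl

𝟙≤1 : ∀ a → 𝟙 a ≤ 1
𝟙≤1 false = z≤n
𝟙≤1 true  = ≤-refl

count-false : count {m} (λ _ → false) ≡ 0
count-false {m} = sum-replicate-zero m

count-mono : (∀ i → p i ≡ true → q i ≡ true) → count p ≤ count q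
count-mono p⊆q = sum-mono-≤ (λ i → 𝟙-mono (p⊆q i))

count-pos : ∀ {x} → p x ≡ true → 1 ≤ count p
count-pos {suc m} {p} {F.zero}  px rewrite px = s≤s z≤n
count-pos {suc m} {p} {F.suc x} px = ≤-trans (count-pos {p = p ∘ F.suc} px) (m≤n+m _ _)

count-strict : (∀ i → p i ≡ true → q i ≡ true) → ∀ {x} → p x ≡ false → q x ≡ true →
               suc (count p) ≤ count q
count-strict {suc m} {p} {q} p⊆q {F.zero} px qx rewrite px | qx =
  s≤s (count-mono (p⊆q ∘ F.suc))
count-strict {suc m} {p} {q} p⊆q {F.suc x} px qx =
  subst (_≤ count q) (+-suc (𝟙 (p F.zero)) _)
    (+-mono-≤ (𝟙-mono (p⊆q F.zero)) (count-strict (p⊆q ∘ F.suc) px qx))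

count-≤-suc : ∀ {x} → (∀ i → p i ≡ true → i ≡ x ⊎ q i ≡ true) → count p ≤ suc (count q)
count-≤-suc {suc m} {p} {q} {F.zero} p⊆x∪q =
  +-mono-≤ (𝟙≤1 (p F.zero))
    (≤-trans (count-mono λ i pi → [ (λ ()) , id ]′ (p⊆x∪q (F.suc i) pi)) (m≤n+m _ _))
count-≤-suc {suc m} {p} {q} {F.suc x} p⊆x∪q =
  subst (count p ≤_) (+-suc (𝟙 (q F.zero)) _)
    (+-mono-≤ (𝟙-mono λ p0 → [ (λ ()) , id ]′ (p⊆x∪q F.zero p0))
      (count-≤-suc λ i pi → Sum.map₁ Fin.suc-injective (p⊆x∪q (F.suc i) pi)))

k≤[1+2k]/2 : ∀ k → k ≤ suc (2 * k) / 2
k≤[1+2k]/2 k = subst (_≤ suc (2 * k) / 2) (m*n/n≡m k 2)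
  (/-monoˡ-≤ 2 (≤-trans (≤-reflexive (*-comm k 2)) (n≤1+n _)))

2*m≤1+2*n⇒m≤n : ∀ {m n} → 2 * m ≤ suc (2 * n) → m ≤ n
2*m≤1+2*n⇒m≤n {m} {n} 2m≤1+2n =
  m<1+n⇒m≤n (*-cancelˡ-< 2 m (suc n) (subst (2 * m <_) (sym (*-suc 2 n)) (s≤s 2m≤1+2n)))

maxL-map-lub : (h : A → ℕ) (xs : List A) {B : ℕ} → (∀ x → h x ≤ B) → maxL (map h xs) ≤ B
maxL-map-lub h []       h≤B = z≤n
maxL-map-lub h (x ∷ xs) h≤B = ⊔-lub (h≤B x) (maxL-map-lub h xs h≤B)

≤-maxL-map : (h : A → ℕ) {xs : List A} {x : A} → x ∈ xs → h x ≤ maxL (map h xs)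
≤-maxL-map h (here refl) = m≤m⊔n _ _
≤-maxL-map h (there x∈xs) = ≤-trans (≤-maxL-map h x∈xs) (m≤n⊔m _ _)

Linked-lookup : ∀ {R : A → A → Set} {k} {xs : Vec A (suc k)} → Linked R xs →
                ∀ i → R (lookup xs (inject₁ i)) (lookup xs (F.suc i))
Linked-lookup {xs = _ ∷ _ ∷ _} (r ∷ _)  F.zero    = r
Linked-lookup {xs = _ ∷ _}     (_ ∷ rs) (F.suc i) = Linked-lookup rs i

closedTrail⇒HasCycle : ∀ {E : Fin m → Fin m → Bool} {k} (xs : Vec (Fin m) (3 + k)) → Unique xs →
  Linked (λ u w → E u w ≡ true) xs → E (lookup xs (fromℕ (2 + k))) (lookup xs F.zero) ≡ true →
  HasCycle E
closedTrail⇒HasCycle {k = k} xs distinct path closing =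
  k , lookup xs , lookup-injective distinct _ _ , Linked-lookup path , closing

module Acyclic {E : Fin m → Fin m → Bool}
  (irrefl : ∀ {u w} → E u w ≡ true → u ≢ w) (acyclic : ¬ HasCycle E) where

  private
    _—_ : Fin m → Fin m → Set
    u — w = E u w ≡ true

    irrefl˘ : ∀ {u w} → u — w → w ≢ u
    irrefl˘ = ≢-sym ∘ irrefl

  no-triangle : ∀ {a b c} → a — b → b — c → c — a → ⊥
  no-triangle ab bc ca = acyclic (closedTrail⇒HasCycle (_ ∷ _ ∷ _ ∷ [])
    ((irrefl ab ∷ irrefl˘ ca ∷ []) ∷ (irrefl bc ∷ []) ∷ [] ∷ [])
    (ab ∷ bc ∷ [-]) ca)

  no-square : ∀ {a b c d} → a — b → b — c → c — d → d — a → a ≢ c → b ≢ d → ⊥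
  no-square ab bc cd da a≢c b≢d = acyclic (closedTrail⇒HasCycle (_ ∷ _ ∷ _ ∷ _ ∷ [])
    ((irrefl ab ∷ a≢c ∷ irrefl˘ da ∷ []) ∷ (irrefl bc ∷ b≢d ∷ []) ∷
     (irrefl cd ∷ []) ∷ [] ∷ [])
    (ab ∷ bc ∷ cd ∷ [-]) da)

  no-pentagon : ∀ {a b c d e} → a — b → b — c → c — d → d — e → e — a →
                a ≢ c → a ≢ d → b ≢ d → b ≢ e → c ≢ e → ⊥
  no-pentagon ab bc cd de ea a≢c a≢d b≢d b≢e c≢e =
    acyclic (closedTrail⇒HasCycle (_ ∷ _ ∷ _ ∷ _ ∷ _ ∷ [])
    ((irrefl ab ∷ a≢c ∷ a≢d ∷ irrefl˘ ea ∷ []) ∷ (irrefl bc ∷ b≢d ∷ b≢e ∷ []) ∷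
     (irrefl cd ∷ c≢e ∷ []) ∷ (irrefl de ∷ []) ∷ [] ∷ [])
    (ab ∷ bc ∷ cd ∷ de ∷ [-]) ea)

  no-hexagon : ∀ {a b c d e f} → a — b → b — c → c — d → d — e → e — f → f — a →
               a ≢ c → a ≢ d → a ≢ e → b ≢ d → b ≢ e → b ≢ f →
               c ≢ e → c ≢ f → d ≢ f → ⊥
  no-hexagon ab bc cd de ef fa a≢c a≢d a≢e b≢d b≢e b≢f c≢e c≢f d≢f =
    acyclic (closedTrail⇒HasCycle (_ ∷ _ ∷ _ ∷ _ ∷ _ ∷ _ ∷ [])
    ((irrefl ab ∷ a≢c ∷ a≢d ∷ a≢e ∷ irrefl˘ fa ∷ []) ∷
     (irrefl bc ∷ b≢d ∷ b≢e ∷ b≢f ∷ []) ∷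
     (irrefl cd ∷ c≢e ∷ c≢f ∷ []) ∷
     (irrefl de ∷ d≢f ∷ []) ∷
     (irrefl ef ∷ []) ∷ [] ∷ [])
    (ab ∷ bc ∷ cd ∷ de ∷ ef ∷ [-]) fa)

module Adjacency (G : Graph) where

  infix 4 _~_
  _~_ : Fin (n G) → Fin (n G) → Set
  u ~ w = adj G u w ≡ true

  ~-sym : ∀ {u w} → u ~ w → w ~ u
  ~-sym {u} {w} u~w = trans (adj-sym G w u) u~w

  ~-irrefl : ∀ {u w} → u ~ w → u ≢ w
  ~-irrefl {u} u~u refl with trans (sym u~u) (irref G u)
  ... | ()

module TreeTwoSpanner (G : Graph) (T : Fin (n G) → Fin (n G) → Bool)
  (T-sym : ∀ u v → T u v ≡ T v u) (T⊆G : ∀ u v → T u v ≡ true → adj G u v ≡ true)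
  (acyclic : ¬ HasCycle T) (stretch≤2 : ∀ u w → adj G u w ≡ true → DistLE T u w 2) where

  open Adjacency G

  infix 4 _─_
  _─_ : Fin (n G) → Fin (n G) → Set
  u ─ w = T u w ≡ true

  ─-sym : ∀ {u w} → u ─ w → w ─ u
  ─-sym {u} {w} u─w = trans (T-sym w u) u─w

  ─-irrefl : ∀ {u w} → u ─ w → u ≢ w
  ─-irrefl {u} {w} = ~-irrefl ∘ T⊆G u w

  open Acyclic ─-irrefl acyclic

  edge⇒tree-edge-or-path : ∀ {u w} → u ~ w → u ─ w ⊎ ∃ λ z → u ─ z × z ─ w
  edge⇒tree-edge-or-path {u} {w} u~w with stretch≤2 u w u~w
  ... | 0 , _ , here                        = ⊥-elim (~-irrefl u~w refl)
  ... | 1 , _ , step u─w here               = inj₁ u─w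
  ... | 2 , _ , step u─z (step z─w here)    = inj₂ (_ , u─z , z─w)
  ... | suc (suc (suc _)) , s≤s (s≤s ()) , _

  module _ {p q m r} (p≢q : p ≢ q) (p─m : p ─ m) (m─q : m ─ q) (r~p : r ~ p) (r~q : r ~ q)
           (r≢m : r ≢ m) where

    no-shortcut : ¬ p ─ q
    no-shortcut p─q = no-triangle p─m m─q (─-sym p─q)

    edge-edge : r ─ p → r ─ q → ⊥
    edge-edge r─p r─q = no-square r─p p─m m─q (─-sym r─q) r≢m p≢q

    edge-path : ∀ {z} → r ─ p → r ─ z → z ─ q → z ≡ m
    edge-path {z} r─p r─z z─q with z F.≟ m | z F.≟ p
    ... | yes z≡m | _        = z≡m
    ... | no _    | yes refl = ⊥-elim (no-shortcut z─q)
    ... | no z≢m  | no z≢p   = ⊥-elim (no-pentagon r─p p─m m─q (─-sym z─q) (─-sym r─z)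
                                  r≢m (~-irrefl r~q) p≢q (≢-sym z≢p) (≢-sym z≢m))

    path-path : ∀ {z₁ z₂} → r ─ z₁ → z₁ ─ p → r ─ z₂ → z₂ ─ q → z₁ ≡ m ⊎ z₂ ≡ m
    path-path {z₁} {z₂} r─z₁ z₁─p r─z₂ z₂─q
      with z₁ F.≟ m | z₂ F.≟ m | z₁ F.≟ z₂ | z₁ F.≟ q | z₂ F.≟ p
    ... | yes z₁≡m | _        | _        | _        | _        = inj₁ z₁≡m
    ... | no _     | yes z₂≡m | _        | _        | _        = inj₂ z₂≡m
    ... | no z₁≢m  | no _     | yes refl | _        | _        =
      ⊥-elim (no-square z₁─p p─m m─q (─-sym z₂─q) z₁≢m p≢q)
    ... | no _     | no _     | no _     | yes refl | _        = ⊥-elim (no-shortcut (─-sym z₁─p))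
    ... | no _     | no _     | no _     | no _     | yes refl = ⊥-elim (no-shortcut z₂─q)
    ... | no z₁≢m  | no z₂≢m  | no z₁≢z₂ | no z₁≢q  | no z₂≢p =
      ⊥-elim (no-hexagon (─-sym z₁─p) (─-sym r─z₁) r─z₂ z₂─q (─-sym m─q) (─-sym p─m)
        (≢-sym (~-irrefl r~p)) (≢-sym z₂≢p) p≢q z₁≢z₂ z₁≢q z₁≢m
        (~-irrefl r~q) r≢m z₂≢m)

  -- The tree paths of length ≤ 2 from r to p and to q, closed up by p ─ m ─ q,
  -- form a cycle of length at most 6 unless one of them passes through m.
  common-neighbour-of-path-ends : ∀ {p q m r} → p ≢ q → p ─ m → m ─ q → r ~ p → r ~ q →
                                  r ≡ m ⊎ r ─ m
  common-neighbour-of-path-ends {p} {q} {m} {r} p≢q p─m m─q r~p r~q with r F.≟ m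
  ... | yes r≡m = inj₁ r≡m
  ... | no r≢m with edge⇒tree-edge-or-path r~p | edge⇒tree-edge-or-path r~q
  ...   | inj₁ r─p | inj₁ r─q =
    ⊥-elim (edge-edge p≢q p─m m─q r~p r~q r≢m r─p r─q)
  ...   | inj₁ r─p | inj₂ (_ , r─z , z─q) =
    inj₂ (subst (r ─_) (edge-path p≢q p─m m─q r~p r~q r≢m r─p r─z z─q) r─z)
  ...   | inj₂ (_ , r─z , z─p) | inj₁ r─q =
    inj₂ (subst (r ─_) (edge-path (≢-sym p≢q) (─-sym m─q) (─-sym p─m) r~q r~p r≢m r─q r─z z─p) r─z)
  ...   | inj₂ (_ , r─z₁ , z₁─p) | inj₂ (_ , r─z₂ , z₂─q) =
    inj₂ ([ (λ z₁≡m → subst (r ─_) z₁≡m r─z₁) , (λ z₂≡m → subst (r ─_) z₂≡m r─z₂) ]′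
           (path-path p≢q p─m m─q r~p r~q r≢m r─z₁ z₁─p r─z₂ z₂─q))

  IsCentre : (Fin (n G) → Bool) → Fin (n G) → Set
  IsCentre inX c = ∀ x → inX x ≡ true → x ≡ c ⊎ x ─ c

  module _ (inX : Fin (n G) → Bool)
           (X-clique : ∀ u v → inX u ≡ true → inX v ≡ true → u ≢ v → adj G u v ≡ true) where

    midpoint-isCentre : ∀ {p q m} → inX p ≡ true → inX q ≡ true → p ≢ q → p ─ m → m ─ q →
                        IsCentre inX m
    midpoint-isCentre {p} {q} p∈X q∈X p≢q p─m m─q x x∈X with x F.≟ p | x F.≟ q
    ... | yes refl | _        = inj₂ p─m
    ... | no _     | yes refl = inj₂ (─-sym m─q)
    ... | no x≢p   | no x≢q   = common-neighbour-of-path-ends p≢q p─m m─q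
                                  (X-clique x p x∈X p∈X x≢p) (X-clique x q x∈X q∈X x≢q)

    -- Among three mutually T-adjacent clique vertices there would be a triangle,
    -- so some pair is joined by a tree path of length two.
    centre : ∀ {a b c} → inX a ≡ true → inX b ≡ true → inX c ≡ true →
             a ≢ b → a ≢ c → b ≢ c → ∃ (IsCentre inX)
    centre {a} {b} {c} a∈X b∈X c∈X a≢b a≢c b≢c
      with edge⇒tree-edge-or-path (X-clique a b a∈X b∈X a≢b)
    ... | inj₂ (_ , a─z , z─b) = _ , midpoint-isCentre a∈X b∈X a≢b a─z z─b
    ... | inj₁ a─b with edge⇒tree-edge-or-path (X-clique b c b∈X c∈X b≢c)
    ...   | inj₂ (_ , b─z , z─c) = _ , midpoint-isCentre b∈X c∈X b≢c b─z z─c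
    ...   | inj₁ b─c with edge⇒tree-edge-or-path (X-clique c a c∈X a∈X (≢-sym a≢c))
    ...     | inj₂ (_ , c─z , z─a) = _ , midpoint-isCentre c∈X a∈X (≢-sym a≢c) c─z z─a
    ...     | inj₁ c─a = ⊥-elim (no-triangle a─b b─c c─a)

    centre-~-two-clique-neighbours : ∀ {c y a b} → IsCentre inX c → inX c ≡ true → inX y ≡ false →
      inX a ≡ true → inX b ≡ true → a ≢ b → y ~ a → y ~ b → c ~ y
    centre-~-two-clique-neighbours {c} {y} {a} {b} c-centre c∈X y∉X a∈X b∈X a≢b y~a y~b
      with c-centre a a∈X | c-centre b b∈X
    ... | inj₁ refl | _         = ~-sym y~a
    ... | _         | inj₁ refl = ~-sym y~b
    ... | inj₂ a─c  | inj₂ b─c with common-neighbour-of-path-ends a≢b a─c (─-sym b─c) y~a y~b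
    ...   | inj₁ refl = ⊥-elim (true≢false (trans (sym c∈X) y∉X))
    ...   | inj₂ y─c  = ~-sym (T⊆G y c y─c)

module Degrees (G : Graph) where

  open Adjacency G

  private
    V = Fin (n G)
    variable
      S : V → Bool
      u v w x y : V

  deg≡count : deg G v ≡ count (adj G v)
  deg≡count {v} = countB-tabulate (adj G v) id

  degIn≡count : degIn G S v ≡ count (λ w → S w ∧ adj G v w)
  degIn≡count {S} {v} = countB-tabulate (λ w → S w ∧ adj G v w) id

  nV≡count : nV[_] G S ≡ count S
  nV≡count {S} = countB-tabulate S id

  deg≤Δ : deg G v ≤ Δ G
  deg≤Δ = ≤-maxL-map (deg G) (∈-allFin _)

  degOn : (V → Bool) → V → ℕ
  degOn S u = if S u then degIn G S u else 0

  Δ[]-lub : ∀ {B} → (∀ u → S u ≡ true → degIn G S u ≤ B) → Δ[_] G S ≤ B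
  Δ[]-lub {S} h = maxL-map-lub (degOn S) (verts G) bound
    where
    bound : ∀ u → degOn S u ≤ _
    bound u with S u in Su
    ... | true  = h u Su
    ... | false = z≤n

  degIn≤Δ[] : S u ≡ true → degIn G S u ≤ Δ[_] G S
  degIn≤Δ[] {S} {u} Su = subst (_≤ Δ[_] G S) (cong (if_then degIn G S u else 0) Su)
    (≤-maxL-map (degOn S) (∈-allFin u))

  N[]-self : N[_] G v v ≡ true
  N[]-self {v} with v F.≟ v
  ... | yes _   = refl
  ... | no v≢v = ⊥-elim (v≢v refl)

  N[]-adj : v ~ w → N[_] G v w ≡ true
  N[]-adj {v} {w} v~w with v F.≟ w
  ... | yes _ = refl
  ... | no _  = v~w

  N[]-elim : N[_] G v w ≡ true → w ≡ v ⊎ v ~ w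
  N[]-elim {v} {w} w∈N[v] with v F.≟ w
  ... | yes v≡w = inj₁ (sym v≡w)
  ... | no _    = inj₂ w∈N[v]

  N[]-∉ : w ≢ v → adj G v w ≡ false → N[_] G v w ≡ false
  N[]-∉ {w} {v} w≢v v≁w with v F.≟ w
  ... | yes v≡w = ⊥-elim (w≢v (sym v≡w))
  ... | no _    = v≁w

  degIn≤deg : degIn G S u ≤ deg G u
  degIn≤deg {S} = subst₂ _≤_ (sym degIn≡count) (sym deg≡count)
    (count-mono λ w → ∧-conicalʳ (S w) _)

  degIn<nV : S u ≡ true → degIn G S u < nV[_] G S
  degIn<nV {S} {u} Su = subst₂ _<_ (sym degIn≡count) (sym nV≡count)
    (count-strict (λ w → ∧-conicalˡ (S w) _) (trans (cong (S u ∧_) (irref G u)) (∧-zeroʳ (S u))) Su)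

  nV-N[] : nV[_] G (N[_] G v) ≡ suc (deg G v)
  nV-N[] {v} = begin
    nV[_] G (N[_] G v)       ≡⟨ nV≡count ⟩
    count (N[_] G v)         ≡⟨ ≤-antisym (count-≤-suc (λ w → N[]-elim {v} {w}))
                                          (count-strict (λ w → N[]-adj {v} {w}) (irref G v) N[]-self) ⟩
    suc (count (adj G v))    ≡⟨ cong suc deg≡count ⟨
    suc (deg G v)            ∎
    where open ≡-Reasoning

  N[]⊂N[]⇒deg<deg : (∀ u → N[_] G v u ≡ true → N[_] G w u ≡ true) →
                    N[_] G v x ≡ false → N[_] G w x ≡ true → deg G v < deg G w
  N[]⊂N[]⇒deg<deg {v} {w} N[v]⊆N[w] x∉N[v] x∈N[w] = s≤s⁻¹ (begin-strict
    suc (deg G v)         ≡⟨ nV-N[] ⟨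
    nV[_] G (N[_] G v)    ≡⟨ nV≡count ⟩
    count (N[_] G v)      <⟨ count-strict N[v]⊆N[w] x∉N[v] x∈N[w] ⟩
    count (N[_] G w)      ≡⟨ nV≡count ⟨
    nV[_] G (N[_] G w)    ≡⟨ nV-N[] ⟩
    suc (deg G w)         ∎)
    where open ≤-Reasoning

  deg≤degIn-N[] : deg G v ≤ degIn G (N[_] G v) v
  deg≤degIn-N[] {v} = subst₂ _≤_ (sym deg≡count) (sym degIn≡count)
    (count-mono {q = λ w → N[_] G v w ∧ adj G v w} λ w v~w → cong₂ _∧_ (N[]-adj v~w) v~w)

  another-neighbour : ¬ Pendant G u → u ~ x → ∃ λ y → x ≢ y × u ~ y
  another-neighbour {u} {x} ¬pendant u~x
    with Fin.any? (λ y → ¬? (x F.≟ y) ×-dec (adj G u y Bool.≟ true))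
  ... | yes found = found
  ... | no none   = ⊥-elim (¬pendant (≤-antisym deg≤1 1≤deg))
    where
    only-x : ∀ y → u ~ y → y ≡ x ⊎ false ≡ true
    only-x y u~y with x F.≟ y
    ... | yes x≡y = inj₁ (sym x≡y)
    ... | no x≢y  = ⊥-elim (none (y , x≢y , u~y))
    deg≤1 : deg G u ≤ 1
    deg≤1 = subst₂ _≤_ (sym deg≡count) (cong suc (count-false {n G}))
                       (count-≤-suc {q = λ _ → false} only-x)
    1≤deg : 1 ≤ deg G u
    1≤deg = subst (1 ≤_) (sym deg≡count) (count-pos {p = adj G u} u~x)

  Δ[N[]]≤deg : Δ[_] G (N[_] G v) ≤ deg G v
  Δ[N[]]≤deg {v} = Δ[]-lub λ u u∈N[v] →
    m<1+n⇒m≤n (subst (degIn G (N[_] G v) u <_) nV-N[] (degIn<nV u∈N[v]))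

  Δ[N[]]≡Δ : deg G v ≡ Δ G → Δ[_] G (N[_] G v) ≡ Δ G
  Δ[N[]]≡Δ {v} deg≡Δ = ≤-antisym (Δ[]-lub λ _ _ → ≤-trans degIn≤deg deg≤Δ)
    (subst (_≤ Δ[_] G (N[_] G v)) deg≡Δ (≤-trans deg≤degIn-N[] (degIn≤Δ[] (N[]-self {v}))))

  Δ[N[]]≡Δ⇒deg≡Δ : Δ[_] G (N[_] G v) ≡ Δ G → deg G v ≡ Δ G
  Δ[N[]]≡Δ⇒deg≡Δ {v} Δ[N[v]]≡Δ = ≤-antisym deg≤Δ (subst (_≤ deg G v) Δ[N[v]]≡Δ Δ[N[]]≤deg)

  inducedEdge : (V → Bool) → V → V → Bool
  inducedEdge S u w = S u ∧ S w ∧ (toℕ u <ᵇ toℕ w) ∧ adj G u w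

  nE≡∑count : ∀ S → nE[_] G S ≡ ∑[ u < n G ] count (inducedEdge S u)
  nE≡∑count S = trans (foldr-+-tabulate (λ u → countB (inducedEdge S u) (verts G)) id)
                      (sum-cong-≗ λ u → countB-tabulate (inducedEdge S u) id)

  inducedEdge-orientations : ∀ S u w →
    𝟙 (inducedEdge S u w) + 𝟙 (inducedEdge S w u) ≤ 𝟙 (S u ∧ (S w ∧ adj G u w))
  inducedEdge-orientations S u w rewrite adj-sym G w u with S u | S w
  ... | false | false = z≤n
  ... | false | true  = z≤n
  ... | true  | false = z≤n
  ... | true  | true  with toℕ u <ᵇ toℕ w in u<w | toℕ w <ᵇ toℕ u in w<u | adj G u w
  ...   | true  | true  | _     = ⊥-elim (<-asym (<ᵇ⇒< (toℕ u) (toℕ w) (subst Bool.T (sym u<w) _))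
                                                (<ᵇ⇒< (toℕ w) (toℕ u) (subst Bool.T (sym w<u) _)))
  ...   | true  | false | true  = ≤-refl
  ...   | true  | false | false = z≤n
  ...   | false | true  | true  = ≤-refl
  ...   | false | true  | false = z≤n
  ...   | false | false | _     = z≤n

  degOn≡count : ∀ S u → count (λ w → S u ∧ (S w ∧ adj G u w)) ≡ degOn S u
  degOn≡count S u with S u
  ... | true  = sym degIn≡count
  ... | false = count-false {n G}

  handshake-≤ : ∀ S → 2 * nE[_] G S ≤ ∑[ u < n G ] degOn S u
  handshake-≤ S = begin
    2 * nE[_] G S                                  ≡⟨ cong (2 *_) (nE≡∑count S) ⟩
    E + (E + 0)                                    ≡⟨ cong (E +_) (+-identityʳ E) ⟩
    E + E                                          ≡⟨ cong (E +_) (∑-comm e) ⟩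
    E + ∑[ u < n G ] ∑[ w < n G ] e w u
      ≡⟨ ∑-distrib-+ (λ u → ∑[ w < n G ] e u w) (λ u → ∑[ w < n G ] e w u) ⟨
    ∑[ u < n G ] (∑[ w < n G ] e u w + ∑[ w < n G ] e w u)
      ≡⟨ sum-cong-≗ (λ u → ∑-distrib-+ (e u) (λ w → e w u)) ⟨
    ∑[ u < n G ] ∑[ w < n G ] (e u w + e w u)
      ≤⟨ sum-mono-≤ (λ u → sum-mono-≤ (inducedEdge-orientations S u)) ⟩
    ∑[ u < n G ] count (λ w → S u ∧ (S w ∧ adj G u w))
      ≡⟨ sum-cong-≗ (degOn≡count S) ⟩
    ∑[ u < n G ] degOn S u                         ∎
    where
    open ≤-Reasoning
    e : V → V → ℕ
    e u w = 𝟙 (inducedEdge S u w)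
    E : ℕ
    E = ∑[ u < n G ] ∑[ w < n G ] e u w

  ∑degOn-N[]≤ : ∀ {v p} → deg G v ≡ Δ G → v ~ p → Pendant G p →
                ∑[ u < n G ] degOn (N[_] G v) u ≤ Δ G * Δ G + 1
  ∑degOn-N[]≤ {v} {p} deg≡Δ v~p pendant = +-cancelˡ-≤ (Δ G) _ _ (begin
    Δ G + ∑[ u < n G ] degOn Nv u        ≡⟨ +-comm (Δ G) _ ⟩
    ∑[ u < n G ] degOn Nv u + Δ G        ≤⟨ sum-mono-≤-slack degOn≤Δ p slack ⟩
    ∑[ u < n G ] (𝟙 (Nv u) * Δ G) + 1    ≡⟨ cong (_+ 1) (*-distribʳ-sum (Δ G) (𝟙 ∘ Nv)) ⟨
    count Nv * Δ G + 1                   ≡⟨ cong (λ s → s * Δ G + 1) |Nv|≡1+Δ ⟩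
    suc (Δ G) * Δ G + 1                 ≡⟨ +-assoc (Δ G) (Δ G * Δ G) 1 ⟩
    Δ G + (Δ G * Δ G + 1)               ∎)
    where
    open ≤-Reasoning
    Nv = N[_] G v
    |Nv|≡1+Δ : count Nv ≡ suc (Δ G)
    |Nv|≡1+Δ = trans (sym nV≡count) (trans nV-N[] (cong suc deg≡Δ))
    degOn≤Δ : ∀ u → degOn Nv u ≤ 𝟙 (Nv u) * Δ G
    degOn≤Δ u with Nv u
    ... | true  = subst (degIn G Nv u ≤_) (sym (*-identityˡ (Δ G))) (≤-trans degIn≤deg deg≤Δ)
    ... | false = z≤n
    slack : degOn Nv p + Δ G ≤ 𝟙 (Nv p) * Δ G + 1
    slack rewrite N[]-adj v~p | *-identityˡ (Δ G) = subst (degIn G Nv p + Δ G ≤_) (+-comm 1 (Δ G))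
      (+-monoˡ-≤ (Δ G) (≤-trans degIn≤deg (≤-reflexive pendant)))

  pendant-neighbour⇒¬Overfull : ∀ {k v p} → Δ G ≡ 2 * k → deg G v ≡ Δ G → v ~ p → Pendant G p →
                                ¬ Overfull G (N[_] G v)
  pendant-neighbour⇒¬Overfull {k} {v} {p} Δ≡2k deg≡Δ v~p pendant overfull = <⇒≱ overfull (begin
    nE[_] G Nv                    ≤⟨ 2*m≤1+2*n⇒m≤n 2|E|≤2Δk+1 ⟩
    Δ G * k                       ≤⟨ *-monoʳ-≤ (Δ G) (k≤[1+2k]/2 k) ⟩
    Δ G * (suc (2 * k) / 2)       ≡⟨ cong₂ (λ d s → d * (s / 2)) (Δ[N[]]≡Δ deg≡Δ) |Nv|≡1+2k ⟨
    Δ[_] G Nv * (nV[_] G Nv / 2)  ∎)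
    where
    open ≤-Reasoning
    Nv = N[_] G v
    |Nv|≡1+2k : nV[_] G Nv ≡ suc (2 * k)
    |Nv|≡1+2k = trans nV-N[] (cong suc (trans deg≡Δ Δ≡2k))
    Δ²≡2Δk : Δ G * Δ G ≡ 2 * (Δ G * k)
    Δ²≡2Δk = trans (cong (Δ G *_) Δ≡2k) (x∙yz≈y∙xz (Δ G) 2 k)
    2|E|≤2Δk+1 : 2 * nE[_] G Nv ≤ suc (2 * (Δ G * k))
    2|E|≤2Δk+1 = ≤-trans (handshake-≤ Nv)
      (subst (∑[ u < n G ] degOn Nv u ≤_) (trans (+-comm _ 1) (cong suc Δ²≡2Δk))
             (∑degOn-N[]≤ deg≡Δ v~p pendant))

connected⇒neighbour : ∀ G → Connected G → ∀ {u x} → u ≢ x → ∃ λ w → adj G u w ≡ true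
connected⇒neighbour G connected {u} {x} u≢x with connected u x
... | _ , here       = ⊥-elim (u≢x refl)
... | _ , step u~w _ = _ , u~w

module SplitGraph (G : Graph) (inX : Fin (n G) → Bool) (split : IsSplit G inX) where

  open Adjacency G
  open Degrees G

  X-clique : ∀ u v → inX u ≡ true → inX v ≡ true → u ≢ v → u ~ v
  X-clique = proj₁ split

  Y-independent : ∀ u v → inX u ≡ false → inX v ≡ false → adj G u v ≡ false
  Y-independent = proj₁ (proj₂ split)

  X-maximal : ∀ y → inX y ≡ false → ¬ (∀ x → inX x ≡ true → y ~ x)
  X-maximal = proj₂ (proj₂ split)

  neighbour-of-Y∈X : ∀ {y x} → inX y ≡ false → y ~ x → inX x ≡ true
  neighbour-of-Y∈X {y} {x} y∉X y~x with inX x in x∈X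
  ... | true  = refl
  ... | false = ⊥-elim (true≢false (trans (sym y~x) (Y-independent y x y∉X x∈X)))

  non-neighbour-of-X∉X : ∀ {v w} → inX v ≡ true → w ≢ v → adj G v w ≡ false → inX w ≡ false
  non-neighbour-of-X∉X {v} {w} v∈X w≢v v≁w with inX w in w∈X
  ... | false = refl
  ... | true  = ⊥-elim (true≢false (trans (sym (X-clique v w v∈X w∈X (≢-sym w≢v))) v≁w))

  Y-non-neighbour : ∀ {y} → inX y ≡ false → ∃ λ x → inX x ≡ true × adj G y x ≡ false
  Y-non-neighbour {y} y∉X
    with Fin.any? (λ x → (inX x Bool.≟ true) ×-dec ¬? (adj G y x Bool.≟ true))
  ... | yes (x , x∈X , y≁x) = x , x∈X , ¬-not y≁x
  ... | no none = ⊥-elim (X-maximal y y∉X λ x x∈X →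
                    decidable-stable (adj G y x Bool.≟ true) λ y≁x → none (x , x∈X , y≁x))

  -- N(y) is a proper subset of X, while X ∖ {x} ∪ {y} ⊆ N(x).
  deg-Y<deg-neighbour : ∀ {y x} → inX y ≡ false → y ~ x → deg G y < deg G x
  deg-Y<deg-neighbour {y} {x} y∉X y~x with Y-non-neighbour y∉X
  ... | z , z∈X , y≁z = s≤s⁻¹ (begin-strict
    suc (deg G y)         ≡⟨ cong suc deg≡count ⟩
    suc (count (adj G y)) <⟨ s≤s (count-strict (λ u → neighbour-of-Y∈X {x = u} y∉X) y≁z z∈X) ⟩
    suc (count inX)       ≤⟨ count-strict X⊆N[x] y∉X (N[]-adj (~-sym y~x)) ⟩
    count (N[_] G x)      ≡⟨ nV≡count ⟨
    nV[_] G (N[_] G x)    ≡⟨ nV-N[] ⟩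
    suc (deg G x)         ∎)
    where
    open ≤-Reasoning
    x∈X = neighbour-of-Y∈X y∉X y~x
    X⊆N[x] : ∀ u → inX u ≡ true → N[_] G x u ≡ true
    X⊆N[x] u u∈X with u F.≟ x
    ... | yes refl = N[]-self
    ... | no u≢x   = N[]-adj (X-clique x u x∈X u∈X (≢-sym u≢x))

  maxDegree∈X : Connected G → ∀ {v} → deg G v ≡ Δ G → inX v ≡ true
  maxDegree∈X connected {v} deg≡Δ with inX v in v∈X
  ... | true  = refl
  ... | false with Y-non-neighbour v∈X
  ...   | x , x∈X , _
    with connected⇒neighbour G connected {v} {x} (λ { refl → true≢false (trans (sym x∈X) v∈X) })
  ...     | w , v~w = ⊥-elim (<-irrefl refl (begin-strict
      deg G v  <⟨ deg-Y<deg-neighbour v∈X v~w ⟩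
      deg G w  ≤⟨ deg≤Δ ⟩
      Δ G      ≡⟨ deg≡Δ ⟨
      deg G v  ∎))
    where open ≤-Reasoning

module OverfullNeighbourhood (G : Graph) (connected : Connected G)
  (inX : Fin (n G) → Bool) (split : IsSplit G inX) (T : Fin (n G) → Fin (n G) → Bool)
  (T-sym : ∀ u v → T u v ≡ T v u) (T⊆G : ∀ u v → T u v ≡ true → adj G u v ≡ true)
  (acyclic : ¬ HasCycle T) (stretch≤2 : ∀ u w → adj G u w ≡ true → DistLE T u w 2) where

  open Adjacency G
  open Degrees G
  open SplitGraph G inX split
  open TreeTwoSpanner G T T-sym T⊆G acyclic stretch≤2

  centre∈X : ∀ {c} → IsCentre inX c → inX c ≡ true
  centre∈X {c} c-centre with inX c in c∈X
  ... | true  = refl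
  ... | false = ⊥-elim (X-maximal c c∈X λ x x∈X → c~X x x∈X (c-centre x x∈X))
    where
    c~X : ∀ x → inX x ≡ true → x ≡ c ⊎ x ─ c → c ~ x
    c~X x x∈X (inj₁ refl) = ⊥-elim (true≢false (trans (sym x∈X) c∈X))
    c~X x x∈X (inj₂ x─c)  = ~-sym (T⊆G x c x─c)

  non-neighbour-~-centre : ∀ {v w} → inX v ≡ true → w ≢ v → ¬ Pendant G w → adj G v w ≡ false →
                           ∃ λ c → IsCentre inX c × c ~ w
  non-neighbour-~-centre {v} {w} v∈X w≢v ¬pendant v≁w =
    let a , w~a       = connected⇒neighbour G connected w≢v
        b , a≢b , w~b = another-neighbour ¬pendant w~a
        a∈X           = neighbour-of-Y∈X w∉X w~a
        b∈X           = neighbour-of-Y∈X w∉X w~b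
        c , c-centre  = centre inX X-clique a∈X b∈X v∈X a≢b (≢v w~a) (≢v w~b)
    in c , c-centre ,
       centre-~-two-clique-neighbours inX X-clique c-centre (centre∈X c-centre) w∉X
         a∈X b∈X a≢b w~a w~b
    where
    w∉X = non-neighbour-of-X∉X v∈X w≢v v≁w
    ≢v : ∀ {x} → w ~ x → x ≢ v
    ≢v w~x refl = true≢false (trans (sym (~-sym w~x)) v≁w)

  non-neighbour⇒pendant-neighbour : ∀ {v w} → deg G v ≡ Δ G → inX v ≡ true →
    w ≢ v → ¬ Pendant G w → adj G v w ≡ false → ∃ λ p → v ~ p × Pendant G p
  non-neighbour⇒pendant-neighbour {v} {w} deg≡Δ v∈X w≢v ¬pendant-w v≁w
    with Fin.any? (λ p → (adj G v p Bool.≟ true) ×-dec (deg G p ℕ.≟ 1))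
       | non-neighbour-~-centre v∈X w≢v ¬pendant-w v≁w
  ... | yes found     | _                 = found
  ... | no no-pendant | c , c-centre , c~w = ⊥-elim (<-irrefl refl (begin-strict
        deg G v  <⟨ N[]⊂N[]⇒deg<deg N[v]⊆N[c] (N[]-∉ w≢v v≁w) (N[]-adj c~w) ⟩
        deg G c  ≤⟨ deg≤Δ ⟩
        Δ G      ≡⟨ deg≡Δ ⟨
        deg G v  ∎))
    where
    open ≤-Reasoning
    c∈X = centre∈X c-centre
    c≢v : c ≢ v
    c≢v refl = true≢false (trans (sym c~w) v≁w)
    c~neighbour : ∀ {u} → v ~ u → u ≢ c → c ~ u
    c~neighbour {u} v~u u≢c with inX u in u∈X
    ... | true  = X-clique c u c∈X u∈X (≢-sym u≢c)
    ... | false =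
      let b , v≢b , u~b = another-neighbour (λ pendant → no-pendant (u , v~u , pendant)) (~-sym v~u)
      in centre-~-two-clique-neighbours inX X-clique c-centre c∈X u∈X v∈X
           (neighbour-of-Y∈X u∈X u~b) v≢b (~-sym v~u) u~b
    N[v]⊆N[c] : ∀ u → N[_] G v u ≡ true → N[_] G c u ≡ true
    N[v]⊆N[c] u u∈N[v] with N[]-elim u∈N[v] | u F.≟ c
    ... | inj₁ refl | _        = N[]-adj (X-clique c v c∈X v∈X c≢v)
    ... | inj₂ _    | yes refl = N[]-self
    ... | inj₂ v~u  | no u≢c   = N[]-adj (c~neighbour v~u u≢c)

  overfull⇒universal : ∀ {k v} → Δ G ≡ 2 * k → deg G v ≡ Δ G → Overfull G (N[_] G v) →
                       ∀ w → w ≢ v → ¬ Pendant G w → v ~ w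
  overfull⇒universal {k} {v} Δ≡2k deg≡Δ overfull w w≢v ¬pendant-w with adj G v w in v-w
  ... | true  = refl
  ... | false =
    let _ , v~p , pendant = non-neighbour⇒pendant-neighbour deg≡Δ (maxDegree∈X connected deg≡Δ)
                              w≢v ¬pendant-w v-w
    in ⊥-elim (pendant-neighbour⇒¬Overfull {k} Δ≡2k deg≡Δ v~p pendant overfull)

theorem6 : (G : Graph) → Connected G → (inX : Fin (n G) → Bool) → IsSplit G inX →
    StretchIndexIs G 2 → (∃ λ k → Δ G ≡ 2 * k) →
    NeighborhoodOverfull G ⇔
      (∃ λ v → inX v ≡ true ×
        (∀ w → w ≢ v → ¬ Pendant G w → adj G v w ≡ true) ×
        Δ[_] G (N[_] G v) ≡ Δ G × Overfull G (N[_] G v))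
theorem6 G connected inX split ((T , T-sym , T⊆G , _ , acyclic , stretch≤2) , _) (k , Δ≡2k) =
  mk⇔ (λ (v , deg≡Δ , overfull) →
         v , maxDegree∈X connected deg≡Δ , overfull⇒universal {k} Δ≡2k deg≡Δ overfull ,
         Δ[N[]]≡Δ deg≡Δ , overfull)
      (λ (v , _ , _ , Δ[N[v]]≡Δ , overfull) → v , Δ[N[]]≡Δ⇒deg≡Δ Δ[N[v]]≡Δ , overfull)
  where
  open Degrees G
  open SplitGraph G inX split
  open OverfullNeighbourhood G connected inX split T T-sym T⊆G acyclic stretch≤2
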